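{- Let $\mathcal{D}=(D,\lambda)$ be a temporal digraph with lifetime $2$, where $\lambda(e)$ is a non-empty subset of $\{1,2\}$ for every arc $e$. If $\mathcal{D}$ contains no temporal simple-cycle, then $D$ has no cycle on fewer than $4$ vertices; moreover, for every cycle $C=(a,e_1,b,e_2,c,e_3,d,e_4,a)$ of $D$ on $4$ vertices, $|\lambda(e_i)|=1$ for every $i\in[4]$ and $\lambda(e_1)=\lambda(e_3)\neq\lambda(e_2)=\lambda(e_4)$.
   Context: $D$ is a finite simple digraph (no loops or parallel arcs; opposite arcs allowed). Non-strict model: a temporal walk is a sequence $(v_1,t_1,v_2,\dots,v_q,t_q,v_{q+1})$ with $q\ge1$, $v_iv_{i+1}\in A(D)$, $t_i\in\lambda(v_iv_{i+1})$, and $t_1\le\dots\le t_q$. A temporal $x,x$-path is such a walk with $v_1=v_{q+1}=x$ and $v_1,\dots,v_q$ distinct; its arc set is $\{v_iv_{i+1}:i\in[q]\}$. A cycle of $D$ is a closed directed path $(v_1,\dots,v_q,v_1)$ with $q\ge2$ and $v_1,\dots,v_q$ distinct; $(a,e_1,b,\dots)$ lists vertices and the arcs between consecutive ones. A cycle $C$ is a temporal simple-cycle of $\mathcal{D}$ if there is $x\in V(C)$ and a temporal $x,x$-path whose arc set equals the arc set of $C$. -}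

module Defs where

open import Data.Nat using (ℕ; _≤_)
open import Data.Fin using (Fin)
open import Data.Bool using (Bool; true; false)
open import Data.List using (List; []; _∷_; _++_; map; length)
open import Data.List.Membership.Propositional using (_∈_)
open import Data.List.Relation.Unary.Unique.Propositional using (Unique)
open import Data.Product using (_×_; _,_; Σ; ∃; proj₁)
open import Data.Sum using (_⊎_)
open import Data.Unit using (⊤)
open import Relation.Binary.PropositionalEquality using (_≡_; _≢_)
open import Function.Bundles using (_⇔_)

-- A temporal digraph on vertex set Fin n.
-- arc u v ≡ true  iff  uv is an arc (simple: at most one arc u→v, no loops;
-- opposite arcs allowed).  lab u v t ≡ true iff  t ∈ λ(uv)  (only meaningful on arcs).
record TDigraph : Set where
  field
    n        : ℕ
    arc      : Fin n → Fin n → Bool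
    loopless : ∀ v → arc v v ≡ false
    lab      : Fin n → Fin n → ℕ → Bool

module _ (𝒟 : TDigraph) where
  open TDigraph 𝒟

  V : Set
  V = Fin n

  Lifetime2 : Set
  Lifetime2 = ∀ u v → arc u v ≡ true →
    (∀ t → lab u v t ≡ true → (t ≡ 1 ⊎ t ≡ 2)) × (∃ λ t → lab u v t ≡ true)

  consec : List V → List (V × V)
  consec []           = []
  consec (a ∷ [])     = []
  consec (a ∷ b ∷ r)  = (a , b) ∷ consec (b ∷ r)

  closedArcs : List V → List (V × V)
  closedArcs []       = []
  closedArcs (v ∷ vs) = consec (v ∷ vs ++ v ∷ [])

  IsCycle : List V → Set
  IsCycle vs = 2 ≤ length vs × Unique vs × (∀ e → e ∈ closedArcs vs → arc (proj₁ e) (Data.Product.proj₂ e) ≡ true)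

  -- temporal walk (v1,t1,v2,...,vq,tq,e) given as steps [(v1,t1),...,(vq,tq)] and end vertex e
  WalkOK : List (V × ℕ) → V → Set
  WalkOK []                          e = ⊤
  WalkOK ((v , t) ∷ [])              e = arc v e ≡ true × lab v e t ≡ true
  WalkOK ((v , t) ∷ (w , s) ∷ rest)  e =
    arc v w ≡ true × lab v w t ≡ true × t ≤ s × WalkOK ((w , s) ∷ rest) e

  IsTempPath : V → List (V × ℕ) → Set
  IsTempPath x []              = Data.Empty.⊥
    where import Data.Empty
  IsTempPath x ((v , t) ∷ rest) =
    v ≡ x × Unique (map proj₁ ((v , t) ∷ rest)) × WalkOK ((v , t) ∷ rest) x

  pathArcs : V → List (V × ℕ) → List (V × V)
  pathArcs x s = consec (map proj₁ s ++ x ∷ [])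

  IsTemporalSimpleCycle : List V → Set
  IsTemporalSimpleCycle vs =
    IsCycle vs × Σ V λ x → x ∈ vs × Σ (List (V × ℕ)) λ s →
      IsTempPath x s × (∀ e → (e ∈ pathArcs x s) ⇔ (e ∈ closedArcs vs))

  NoTemporalSimpleCycle : Set
  NoTemporalSimpleCycle = ∀ vs → IsCycle vs → IsTemporalSimpleCycle vs → Data.Empty.⊥
    where import Data.Empty

  SingleLabel : V → V → Set
  SingleLabel u v = ∃ λ t → lab u v t ≡ true × (∀ s → lab u v s ≡ true → s ≡ t)

  SameLabels : V → V → V → V → Set
  SameLabels u v w z = ∀ t → lab u v t ≡ lab w z t

-- A cycle whose arcs can be given non-decreasing times, read from some starting vertex, is a
-- temporal simple-cycle.  With times in {1,2}, a cyclic word of length 2 or 3 always has a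
-- non-decreasing rotation, and one of length 4 has one unless it alternates 1,2,1,2.  So a
-- cycle of length 2 or 3 cannot occur, and on a 4-cycle every choice of one label per arc
-- alternates; varying the label of a single arc then shows that each label set is a singleton.
module Submission where

open import Defs
open import Data.Nat using (_≤_)
open import Data.List using (List; []; _∷_; length)
open import Data.Product using (_×_)
open import Relation.Nullary using (¬_)

open import Data.Nat using (ℕ; zero; suc; z≤n; s≤s)
import Data.Bool as Bool
open import Data.Bool using (Bool; true; false; not; f≤t; b≤b)
open import Data.Bool.Properties using (not-injective; ⇔→≡)
open import Data.Empty using (⊥-elim)
open import Data.Product using (Σ; ∃; ∃-syntax; _,_; proj₁; proj₂)
open import Data.Sum using (_⊎_; inj₁; inj₂; [_,_]′)
open import Data.List using (_++_; _∷ʳ_; map)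
open import Data.List.Relation.Binary.Pointwise using (Pointwise; []; _∷_; ++⁺)
open import Data.List.Relation.Unary.Any using (here; there)
open import Data.List.Relation.Unary.Linked using (Linked; []; [-]; _∷_)
open import Data.List.Membership.Propositional using (_∈_)
open import Data.List.Relation.Binary.Permutation.Propositional using (_↭_; ↭-refl; ↭-sym; ↭⇒↭ₛ)
open import Data.List.Relation.Binary.Permutation.Propositional.Properties
  using (∷↭∷ʳ; ↭-length; ∈-resp-↭)
import Data.List.Relation.Binary.Permutation.Setoid.Properties as Permutationₛ
open import Relation.Binary.PropositionalEquality
  using (_≡_; _≢_; refl; sym; trans; cong; subst; setoid)
open import Function using (id)
open import Function.Bundles using (_⇔_; mk⇔)
open import Function.Construct.Composition using (_⇔-∘_)
open import Function.Construct.Symmetry using (⇔-sym)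

rotate : ∀ {A : Set} → List A → List A
rotate []       = []
rotate (x ∷ xs) = xs ∷ʳ x

rotate^ : ∀ {A : Set} → ℕ → List A → List A
rotate^ zero    xs = xs
rotate^ (suc k) xs = rotate^ k (rotate xs)

rotate-↭ : ∀ {A : Set} (xs : List A) → rotate xs ↭ xs
rotate-↭ []       = ↭-refl
rotate-↭ (x ∷ xs) = ↭-sym (∷↭∷ʳ x xs)

Pointwise-rotate : ∀ {A B : Set} {R : A → B → Set} {xs ys} →
  Pointwise R xs ys → Pointwise R (rotate xs) (rotate ys)
Pointwise-rotate []       = []
Pointwise-rotate (r ∷ rs) = ++⁺ rs (r ∷ [])

Sorted : List Bool → Set
Sorted = Linked Bool._≤_

SortedRotation : List Bool → Set
SortedRotation ws = ∃[ k ] Sorted (rotate^ k ws)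

Alternating : Bool → Bool → Bool → Bool → Set
Alternating x y z w = y ≡ not x × z ≡ x × w ≡ y

sortedRotation₂ : ∀ x y → SortedRotation (x ∷ y ∷ [])
sortedRotation₂ false false = 0 , b≤b ∷ [-]
sortedRotation₂ false true  = 0 , f≤t ∷ [-]
sortedRotation₂ true  false = 1 , f≤t ∷ [-]
sortedRotation₂ true  true  = 0 , b≤b ∷ [-]

sortedRotation₃ : ∀ x y z → SortedRotation (x ∷ y ∷ z ∷ [])
sortedRotation₃ false false false = 0 , b≤b ∷ b≤b ∷ [-]
sortedRotation₃ false false true  = 0 , b≤b ∷ f≤t ∷ [-]
sortedRotation₃ false true  false = 2 , b≤b ∷ f≤t ∷ [-]
sortedRotation₃ false true  true  = 0 , f≤t ∷ b≤b ∷ [-]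
sortedRotation₃ true  false false = 1 , b≤b ∷ f≤t ∷ [-]
sortedRotation₃ true  false true  = 1 , f≤t ∷ b≤b ∷ [-]
sortedRotation₃ true  true  false = 2 , f≤t ∷ b≤b ∷ [-]
sortedRotation₃ true  true  true  = 0 , b≤b ∷ b≤b ∷ [-]

sortedRotation₄ : ∀ x y z w → SortedRotation (x ∷ y ∷ z ∷ w ∷ []) ⊎ Alternating x y z w
sortedRotation₄ false false false false = inj₁ (0 , b≤b ∷ b≤b ∷ b≤b ∷ [-])
sortedRotation₄ false false false true  = inj₁ (0 , b≤b ∷ b≤b ∷ f≤t ∷ [-])
sortedRotation₄ false false true  false = inj₁ (3 , b≤b ∷ b≤b ∷ f≤t ∷ [-])
sortedRotation₄ false false true  true  = inj₁ (0 , b≤b ∷ f≤t ∷ b≤b ∷ [-])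
sortedRotation₄ false true  false false = inj₁ (2 , b≤b ∷ b≤b ∷ f≤t ∷ [-])
sortedRotation₄ false true  false true  = inj₂ (refl , refl , refl)
sortedRotation₄ false true  true  false = inj₁ (3 , b≤b ∷ f≤t ∷ b≤b ∷ [-])
sortedRotation₄ false true  true  true  = inj₁ (0 , f≤t ∷ b≤b ∷ b≤b ∷ [-])
sortedRotation₄ true  false false false = inj₁ (1 , b≤b ∷ b≤b ∷ f≤t ∷ [-])
sortedRotation₄ true  false false true  = inj₁ (1 , b≤b ∷ f≤t ∷ b≤b ∷ [-])
sortedRotation₄ true  false true  false = inj₂ (refl , refl , refl)
sortedRotation₄ true  false true  true  = inj₁ (1 , f≤t ∷ b≤b ∷ b≤b ∷ [-])
sortedRotation₄ true  true  false false = inj₁ (2 , b≤b ∷ f≤t ∷ b≤b ∷ [-])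
sortedRotation₄ true  true  false true  = inj₁ (2 , f≤t ∷ b≤b ∷ b≤b ∷ [-])
sortedRotation₄ true  true  true  false = inj₁ (3 , f≤t ∷ b≤b ∷ b≤b ∷ [-])
sortedRotation₄ true  true  true  true  = inj₁ (0 , b≤b ∷ b≤b ∷ b≤b ∷ [-])

time : Bool → ℕ
time false = 1
time true  = 2

time-mono : ∀ {x y} → x Bool.≤ y → time x ≤ time y
time-mono {false} b≤b = s≤s z≤n
time-mono {true}  b≤b = s≤s (s≤s z≤n)
time-mono f≤t         = s≤s z≤n

time-not : ∀ x → time x ≢ time (not x)
time-not false ()
time-not true  ()

module _ (𝒟 : TDigraph) where
  open TDigraph 𝒟

  consec-∷ʳ : ∀ (xs : List (V 𝒟)) y z → consec 𝒟 (xs ∷ʳ y ∷ʳ z) ≡ consec 𝒟 (xs ∷ʳ y) ++ (y , z) ∷ []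
  consec-∷ʳ []            y z = refl
  consec-∷ʳ (x ∷ [])      y z = refl
  consec-∷ʳ (x ∷ x′ ∷ xs) y z = cong ((x , x′) ∷_) (consec-∷ʳ (x′ ∷ xs) y z)

  closedArcs-rotate : ∀ vs → closedArcs 𝒟 (rotate vs) ≡ rotate (closedArcs 𝒟 vs)
  closedArcs-rotate []           = refl
  closedArcs-rotate (v ∷ [])     = refl
  closedArcs-rotate (v ∷ w ∷ ws) = consec-∷ʳ (w ∷ ws) v w

  IsCycle-rotate : ∀ {vs} → IsCycle 𝒟 vs → IsCycle 𝒟 (rotate vs)
  IsCycle-rotate {vs} (length≥2 , unique , arcs) =
    subst (2 ≤_) (sym (↭-length (rotate-↭ vs))) length≥2 ,
    Permutationₛ.Unique-resp-↭ (setoid (V 𝒟)) (↭⇒↭ₛ (↭-sym (rotate-↭ vs))) unique ,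
    λ e e∈ → arcs e (∈-resp-↭ (rotate-↭ (closedArcs 𝒟 vs)) (subst (e ∈_) (closedArcs-rotate vs) e∈))

  HasLabel : V 𝒟 × V 𝒟 → ℕ → Set
  HasLabel (u , v) t = lab u v t ≡ true

  Timing : List (V 𝒟) → List Bool → Set
  Timing vs ws = Pointwise (λ e x → HasLabel e (time x)) (closedArcs 𝒟 vs) ws

  Timing-rotate : ∀ {vs ws} → Timing vs ws → Timing (rotate vs) (rotate ws)
  Timing-rotate {vs} τ =
    subst (λ es → Pointwise _ es _) (sym (closedArcs-rotate vs)) (Pointwise-rotate τ)

  sortedTiming⇒temporalWalk : ∀ u us e {x xs} →
    (∀ a → a ∈ consec 𝒟 (u ∷ us ++ e ∷ []) → arc (proj₁ a) (proj₂ a) ≡ true) →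
    Pointwise (λ a y → HasLabel a (time y)) (consec 𝒟 (u ∷ us ++ e ∷ [])) (x ∷ xs) →
    Sorted (x ∷ xs) →
    Σ (List (V 𝒟 × ℕ)) λ rest → map proj₁ rest ≡ us × WalkOK 𝒟 ((u , time x) ∷ rest) e
  sortedTiming⇒temporalWalk u []          e arcs (l ∷ []) _ = [] , refl , arcs _ (here refl) , l
  sortedTiming⇒temporalWalk u (_ ∷ [])    e _ (_ ∷ ()) [-]
  sortedTiming⇒temporalWalk u (_ ∷ _ ∷ _) e _ (_ ∷ ()) [-]
  sortedTiming⇒temporalWalk u (w ∷ us)    e arcs (l ∷ ls) (x≤y ∷ sorted)
    with sortedTiming⇒temporalWalk w us e (λ a a∈ → arcs a (there a∈)) ls sorted
  ... | rest , refl , walk = (w , _) ∷ rest , refl , arcs _ (here refl) , l , time-mono x≤y , walk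

  sortedTiming⇒temporalSimpleCycle : ∀ {vs ws} → IsCycle 𝒟 vs → Timing vs ws → Sorted ws →
    IsTemporalSimpleCycle 𝒟 vs
  sortedTiming⇒temporalSimpleCycle {[]}         (() , _) _ _
  sortedTiming⇒temporalSimpleCycle {_ ∷ []}     {[]} _ () _
  sortedTiming⇒temporalSimpleCycle {_ ∷ _ ∷ _} {[]} _ () _
  sortedTiming⇒temporalSimpleCycle {u ∷ us} {x ∷ _} cyc@(_ , unique , arcs) τ sorted
    with sortedTiming⇒temporalWalk u us u arcs τ sorted
  ... | rest , refl , walk =
    cyc , u , here refl , (u , time x) ∷ rest , (refl , unique , walk) , λ _ → mk⇔ id id

  noSortedRotation : NoTemporalSimpleCycle 𝒟 → ∀ {vs ws} → IsCycle 𝒟 vs → Timing vs ws →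
    ¬ SortedRotation ws
  noSortedRotation N cyc τ (zero  , sorted) = N _ cyc (sortedTiming⇒temporalSimpleCycle cyc τ sorted)
  noSortedRotation N {vs} cyc τ (suc k , sorted) =
    noSortedRotation N (IsCycle-rotate cyc) (Timing-rotate {vs} τ) (k , sorted)

  labelTime : Lifetime2 𝒟 → ∀ {u v t} → arc u v ≡ true → lab u v t ≡ true → ∃[ x ] t ≡ time x
  labelTime L {u} {v} uv l with proj₁ (L u v uv) _ l
  ... | inj₁ refl = false , refl
  ... | inj₂ refl = true , refl

  someTime : Lifetime2 𝒟 → ∀ {u v} → arc u v ≡ true → ∃[ x ] HasLabel (u , v) (time x)
  someTime L {u} {v} uv with proj₂ (L u v uv)
  ... | _ , l with labelTime L uv l
  ... | x , refl = x , l

  cycleTiming : Lifetime2 𝒟 → ∀ {vs} → IsCycle 𝒟 vs → ∃ (Timing vs)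
  cycleTiming L (_ , _ , arcs) = timing _ arcs
    where
    timing : ∀ es → (∀ e → e ∈ es → arc (proj₁ e) (proj₂ e) ≡ true) →
      ∃ (Pointwise (λ e x → HasLabel e (time x)) es)
    timing []       _    = [] , []
    timing (e ∷ es) arcs with someTime L (arcs e (here refl)) | timing es (λ a a∈ → arcs a (there a∈))
    ... | x , l | xs , ls = x ∷ xs , l ∷ ls

  cycle-length≥4 : Lifetime2 𝒟 → NoTemporalSimpleCycle 𝒟 → ∀ vs → IsCycle 𝒟 vs → 4 ≤ length vs
  cycle-length≥4 L N []                  (() , _)
  cycle-length≥4 L N (_ ∷ [])            (s≤s () , _)
  cycle-length≥4 L N (_ ∷ _ ∷ [])        cyc with cycleTiming L cyc
  ... | _ , τ@(_ ∷ _ ∷ [])     = ⊥-elim (noSortedRotation N cyc τ (sortedRotation₂ _ _))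
  cycle-length≥4 L N (_ ∷ _ ∷ _ ∷ [])    cyc with cycleTiming L cyc
  ... | _ , τ@(_ ∷ _ ∷ _ ∷ []) = ⊥-elim (noSortedRotation N cyc τ (sortedRotation₃ _ _ _))
  cycle-length≥4 L N (_ ∷ _ ∷ _ ∷ _ ∷ _) _ = s≤s (s≤s (s≤s (s≤s z≤n)))

  OnlyLabel : V 𝒟 → V 𝒟 → ℕ → Set
  OnlyLabel u v t = lab u v t ≡ true × (∀ s → lab u v s ≡ true → s ≡ t)

  OnlyLabel-⇔ : ∀ {u v t} → OnlyLabel u v t → ∀ s → (lab u v s ≡ true) ⇔ (s ≡ t)
  OnlyLabel-⇔ (l , only) s = mk⇔ (only s) λ { refl → l }

  sameLabels : ∀ {u v w z t} → OnlyLabel u v t → OnlyLabel w z t → SameLabels 𝒟 u v w z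
  sameLabels p q s = ⇔→≡ (⇔-sym (OnlyLabel-⇔ q s) ⇔-∘ OnlyLabel-⇔ p s)

  differentLabels : ∀ {u v w z t t′} → OnlyLabel u v t → OnlyLabel w z t′ → t ≢ t′ →
    ¬ SameLabels 𝒟 u v w z
  differentLabels (l , _) (_ , only′) t≢t′ same = t≢t′ (only′ _ (trans (sym (same _)) l))

  onlyLabel : Lifetime2 𝒟 → ∀ {u v x} → arc u v ≡ true → lab u v (time x) ≡ true →
    (∀ y → lab u v (time y) ≡ true → y ≡ x) → OnlyLabel u v (time x)
  onlyLabel L {u} {v} {x} uv l unique = l , only
    where
    only : ∀ s → lab u v s ≡ true → s ≡ time x
    only s ls with labelTime L uv ls
    ... | y , refl = cong time (unique y ls)

  fourCycle-alternates : NoTemporalSimpleCycle 𝒟 → ∀ {a b c d} → IsCycle 𝒟 (a ∷ b ∷ c ∷ d ∷ []) →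
    ∀ {x y z w} → HasLabel (a , b) (time x) → HasLabel (b , c) (time y) →
    HasLabel (c , d) (time z) → HasLabel (d , a) (time w) → Alternating x y z w
  fourCycle-alternates N cyc {x} {y} {z} {w} l₁ l₂ l₃ l₄ =
    [ (λ rotation → ⊥-elim (noSortedRotation N cyc (l₁ ∷ l₂ ∷ l₃ ∷ l₄ ∷ []) rotation)) , id ]′
      (sortedRotation₄ x y z w)

  fourCycle-onlyLabels : Lifetime2 𝒟 → NoTemporalSimpleCycle 𝒟 → ∀ {a b c d} →
    IsCycle 𝒟 (a ∷ b ∷ c ∷ d ∷ []) →
    ∃[ x ] OnlyLabel a b (time x) × OnlyLabel b c (time (not x))
         × OnlyLabel c d (time x) × OnlyLabel d a (time (not x))
  fourCycle-onlyLabels L N cyc@(_ , _ , arcs)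
    with arcs _ (here refl) | arcs _ (there (here refl))
       | arcs _ (there (there (here refl))) | arcs _ (there (there (there (here refl))))
  ... | ab | bc | cd | da with someTime L ab | someTime L bc | someTime L cd | someTime L da
  ... | x , l₁ | _ , l₂ | _ , l₃ | _ , l₄ with fourCycle-alternates N cyc l₁ l₂ l₃ l₄
  ... | refl , refl , refl =
    x , onlyLabel L ab l₁ (λ _ l → not-injective (sym (proj₁ (fourCycle-alternates N cyc l l₂ l₃ l₄))))
      , onlyLabel L bc l₂ (λ _ l → proj₁ (fourCycle-alternates N cyc l₁ l l₃ l₄))
      , onlyLabel L cd l₃ (λ _ l → proj₁ (proj₂ (fourCycle-alternates N cyc l₁ l₂ l l₄)))
      , onlyLabel L da l₄ (λ _ l → proj₂ (proj₂ (fourCycle-alternates N cyc l₁ l₂ l₃ l)))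

proposition5 : (𝒟 : TDigraph) → Lifetime2 𝒟 → NoTemporalSimpleCycle 𝒟 →
    ((vs : List (V 𝒟)) → IsCycle 𝒟 vs → 4 ≤ length vs)
    × (∀ a b c d → IsCycle 𝒟 (a ∷ b ∷ c ∷ d ∷ []) →
        (SingleLabel 𝒟 a b × SingleLabel 𝒟 b c × SingleLabel 𝒟 c d × SingleLabel 𝒟 d a)
        × SameLabels 𝒟 a b c d × ¬ SameLabels 𝒟 a b b c × SameLabels 𝒟 b c d a)
proposition5 𝒟 L N = cycle-length≥4 𝒟 L N , λ _ _ _ _ cyc →
  let x , ab , bc , cd , da = fourCycle-onlyLabels 𝒟 L N cyc
  in ((time x , ab) , (time (not x) , bc) , (time x , cd) , (time (not x) , da)) ,
     sameLabels 𝒟 ab cd , differentLabels 𝒟 ab bc (time-not x) , sameLabels 𝒟 bc da
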